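{- Let $d\geq 2$ and let $S=(V,\mathcal{H})$ be a paving simplicial complex of dimension $d$. Then the following are equivalent: (i) $S$ is boolean representable; (ii) $\mathcal{H}=\bigcup\{\mathcal{B}_d(V,L) : L\in L(S)\setminus(P_{\leq d-1}(V)\cup\{V\})\}$; (iii) there exists a nonempty family $\mathcal{L}\subseteq P_{\geq d}(V)\setminus\{V\}$ with $|L\cap L'|\leq d-1$ for all distinct $L,L'\in\mathcal{L}$, such that $\mathcal{H}=\bigcup_{L\in\mathcal{L}}\mathcal{B}_d(V,L)$. Here $\mathcal{B}_d(V,L)=P_{\leq d}(V)\cup\{X\in P_{d+1}(V) : |X\cap L|=d\}$.
   Context: A (finite) simplicial complex is a pair $S=(V,\mathcal{H})$ where $V$ is a finite nonempty set and $\mathcal{H}\subseteq 2^V$ contains all singletons and is closed under taking subsets. Its dimension is $\max\{|I|:I\in\mathcal{H}\}-1$. $P_n(V)$ (resp. $P_{\leq n}(V)$, $P_{\geq n}(V)$) is the set of subsets of $V$ of size exactly (resp. at most, at least) $n$. $S$ is paving if $P_{\dim S}(V)\subseteq\mathcal{H}$. A flat of $S$ is $X\subseteq V$ with $I\cup\{p\}\in\mathcal{H}$ for all $I\in\mathcal{H}\cap 2^X$, $p\in V\setminus X$; $L(S)$ is the set of flats. $S$ is boolean representable if there is a boolean matrix $M$ with columns indexed by $V$ such that $\mathcal{H}$ is exactly the set of $X\subseteq V$ for which some square submatrix with column set $X$ is congruent (by permuting rows and columns) to a lower unitriangular boolean matrix; equivalently, $\mathcal{H}$ is the set of $X$ admitting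 an enumeration $x_1,\dots,x_k$ and a chain of flats $F_0\subset\cdots\subset F_k$ with $x_i\in F_i\setminus F_{i-1}$. -}

module Defs where

open import Data.Nat using (ℕ; zero; suc; _≤_; _<_; _∸_)
open import Data.Bool using (Bool; true; false; T)
open import Data.Fin as F using (Fin)
open import Data.Fin.Subset using (Subset; ⁅_⁆; _∪_; _∩_; ∣_∣; _⊆_; _∈_; _∉_; ⊤)
open import Data.Product using (Σ; ∃; _×_; _,_)
open import Data.Sum using (_⊎_)
open import Relation.Nullary using (¬_)
open import Relation.Binary.PropositionalEquality using (_≡_; _≢_)
open import Function.Bundles using (_⇔_)
open import Function.Definitions using (Injective)

record SimplicialComplex (n : ℕ) : Set where
  field
    ℋ         : Subset n → Bool
    nonempty  : 0 < n
    singletons : ∀ (x : Fin n) → T (ℋ ⁅ x ⁆)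
    downClosed : ∀ (X Y : Subset n) → Y ⊆ X → T (ℋ X) → T (ℋ Y)

open SimplicialComplex public

Indep : ∀ {n} → SimplicialComplex n → Subset n → Set
Indep S X = T (ℋ S X)

HasDim : ∀ {n} → SimplicialComplex n → ℕ → Set
HasDim S d = (∃ λ I → Indep S I × ∣ I ∣ ≡ suc d) × (∀ I → Indep S I → ∣ I ∣ ≤ suc d)

Paving : ∀ {n} → SimplicialComplex n → ℕ → Set
Paving S d = ∀ X → ∣ X ∣ ≡ d → Indep S X

IsFlat : ∀ {n} → SimplicialComplex n → Subset n → Set
IsFlat S X = ∀ I → Indep S I → I ⊆ X → ∀ p → p ∉ X → Indep S (I ∪ ⁅ p ⁆)

BoolMatrix : ℕ → ℕ → Set
BoolMatrix m n = Fin m → Fin n → Bool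

-- The columns X carry a square submatrix of M congruent (by permuting
-- rows and columns) to a lower unitriangular boolean matrix: there are
-- k = |X| distinct rows r(0..k-1) and an enumeration c(0..k-1) of X with
-- M(r i, c i) = 1 and M(r i, c j) = 0 for j > i.
HasLowerUnitriangular : ∀ {m n} → BoolMatrix m n → Subset n → Set
HasLowerUnitriangular {m} {n} M X =
  ∃ λ (k : ℕ) → Σ (Fin k → Fin m) λ r → Σ (Fin k → Fin n) λ c →
      Injective _≡_ _≡_ r
    × Injective _≡_ _≡_ c
    × (∀ x → x ∈ X ⇔ (∃ λ i → c i ≡ x))
    × (∀ i → M (r i) (c i) ≡ true)
    × (∀ i j → i F.< j → M (r i) (c j) ≡ false)

BooleanRepresentable : ∀ {n} → SimplicialComplex n → Set
BooleanRepresentable {n} S =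
  ∃ λ (m : ℕ) → Σ (BoolMatrix m n) λ M →
    ∀ X → Indep S X ⇔ HasLowerUnitriangular M X

InB : ∀ {n} → ℕ → Subset n → Subset n → Set
InB d L X = ∣ X ∣ ≤ d ⊎ (∣ X ∣ ≡ suc d × ∣ X ∩ L ∣ ≡ d)

-- S is boolean representable iff every independent (d+1)-set X meets some
-- flat in exactly d points.  Given a representation, the zero set of the
-- first row of a triangular submatrix on X is such a flat.  Conversely, the
-- matrix whose rows are the complements of all flats triangularises sets of
-- size at most d by paving, and a (d+1)-set X by extending a triangular
-- d-set X ∩ L with the row of the flat L.  Distinct proper flats cannot share
-- d points, so the big proper flats form a sparse generating family; and
-- every member of a sparse generating family is a flat.
module Submission where

open import Defs
open import Data.Nat using (ℕ; zero; suc; _+_; _≤_; _<_; _∸_; z≤n; s≤s; _≤?_; _<?_)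
open import Data.Nat.Properties
  using ( ≤-trans; ≤-reflexive; ≤-antisym; <⇒≤; ≰⇒>; ≮⇒≥; ≤⇒≯; 1+n≰n; n≤0⇒n≡0; ≤-pred; suc-injective; <-cmp
        ; module ≤-Reasoning)
open import Data.Bool using (Bool; true; false; not; T)
open import Data.Bool.Properties using (not-injective; ¬-not; T-≡; T-not-≡) renaming (_≟_ to _≟ᴮ_)
open import Data.Fin as F using (Fin; zero; suc; _↑ˡ_; _↑ʳ_; splitAt)
open import Data.Fin.Properties using (splitAt-↑ˡ; splitAt-↑ʳ; any?)
open import Data.Fin.Subset
open import Data.Fin.Subset.Properties
open import Data.Vec using ([]; _∷_; here; there; tabulate)
open import Data.Vec.Properties using (lookup∘tabulate; []=⇒lookup; lookup⇒[]=; ≡-dec)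
open import Data.Vec.Functional using () renaming (_∷_ to _∷ᶠ_)
open import Data.Product using (∃; ∃₂; _×_; _,_; proj₁; proj₂)
open import Data.Sum using (inj₁; inj₂; [_,_]′)
open import Data.Empty using (⊥-elim)
open import Function using (_∘_)
open import Function.Bundles using (_⇔_; mk⇔; Equivalence)
open import Function.Definitions using (Injective)
open import Relation.Nullary using (¬_; Dec; yes; no; ¬?; contradiction)
open import Relation.Nullary.Decidable
  using (_×-dec_; ⌊_⌋; toWitness; fromWitness; toWitnessFalse; fromWitnessFalse; decidable-stable; T?)
open import Relation.Binary.PropositionalEquality
open import Relation.Binary.Definitions using (tri<; tri≈; tri>)

open Equivalence using (to; from)

private
  variable
    k m n t : ℕ
    p q : Subset n

≤∸1⇔< : ∀ {a d} → 1 ≤ d → (a ≤ d ∸ 1 ⇔ a < d)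
≤∸1⇔< {d = suc d} _ = mk⇔ s≤s ≤-pred

∣p∪⁅x⁆∣≡1+∣p∣ : ∀ (p : Subset n) x → x ∉ p → ∣ p ∪ ⁅ x ⁆ ∣ ≡ suc ∣ p ∣
∣p∪⁅x⁆∣≡1+∣p∣ (inside ∷ p) zero x∉p = ⊥-elim (x∉p here)
∣p∪⁅x⁆∣≡1+∣p∣ (outside ∷ p) zero _ = cong (suc ∘ ∣_∣) (∪-identityʳ p)
∣p∪⁅x⁆∣≡1+∣p∣ (inside ∷ p) (suc x) x∉p = cong suc (∣p∪⁅x⁆∣≡1+∣p∣ p x (x∉p ∘ there))
∣p∪⁅x⁆∣≡1+∣p∣ (outside ∷ p) (suc x) x∉p = ∣p∪⁅x⁆∣≡1+∣p∣ p x (x∉p ∘ there)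

∣p∣≡0⇒p≡⊥ : ∀ (p : Subset n) → ∣ p ∣ ≡ 0 → p ≡ ⊥
∣p∣≡0⇒p≡⊥ [] _ = refl
∣p∣≡0⇒p≡⊥ (outside ∷ p) ∣p∣≡0 = cong (outside ∷_) (∣p∣≡0⇒p≡⊥ p ∣p∣≡0)

∣p∣≡1+t⇒Nonempty : ∀ (p : Subset n) → ∣ p ∣ ≡ suc t → Nonempty p
∣p∣≡1+t⇒Nonempty (inside ∷ p) _ = zero , here
∣p∣≡1+t⇒Nonempty (outside ∷ p) ∣p∣≡1+t =
  let (x , x∈p) = ∣p∣≡1+t⇒Nonempty p ∣p∣≡1+t in suc x , there x∈p

∃-superset-of-size : ∀ (p : Subset n) t → ∣ p ∣ ≤ t → t ≤ n → ∃ λ q → p ⊆ q × ∣ q ∣ ≡ t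
∃-superset-of-size [] zero _ _ = [] , (λ x∈p → x∈p) , refl
∃-superset-of-size (s ∷ p) zero ∣p∣≤0 _ = s ∷ p , (λ x∈p → x∈p) , n≤0⇒n≡0 ∣p∣≤0
∃-superset-of-size (inside ∷ p) (suc t) (s≤s ∣p∣≤t) (s≤s t≤n) =
  let (q , p⊆q , ∣q∣≡t) = ∃-superset-of-size p t ∣p∣≤t t≤n in inside ∷ q , in⊆in p⊆q , cong suc ∣q∣≡t
∃-superset-of-size (outside ∷ p) (suc t) ∣p∣≤1+t (s≤s t≤n) with ∣ p ∣ ≤? t
... | yes ∣p∣≤t =
  let (q , p⊆q , ∣q∣≡t) = ∃-superset-of-size p t ∣p∣≤t t≤n in inside ∷ q , out⊆ p⊆q , cong suc ∣q∣≡t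
... | no ∣p∣≰t = outside ∷ p , (λ x∈p → x∈p) , ≤-antisym ∣p∣≤1+t (≰⇒> ∣p∣≰t)

∃-subset-of-size : ∀ (p : Subset n) t → t ≤ ∣ p ∣ → ∃ λ q → q ⊆ p × ∣ q ∣ ≡ t
∃-subset-of-size {n} p zero _ = ⊥ , ⊥⊆ , ∣⊥∣≡0 n
∃-subset-of-size (inside ∷ p) (suc t) (s≤s t≤∣p∣) =
  let (q , q⊆p , ∣q∣≡t) = ∃-subset-of-size p t t≤∣p∣ in inside ∷ q , in⊆in q⊆p , cong suc ∣q∣≡t
∃-subset-of-size (outside ∷ p) (suc t) t<∣p∣ =
  let (q , q⊆p , ∣q∣≡1+t) = ∃-subset-of-size p (suc t) t<∣p∣ in outside ∷ q , out⊆ q⊆p , ∣q∣≡1+t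

∣p∣≡1+t⇒p≡q∪⁅x⁆ : ∀ (p : Subset n) → ∣ p ∣ ≡ suc t →
  ∃₂ λ q x → x ∉ q × p ≡ q ∪ ⁅ x ⁆ × ∣ q ∣ ≡ t
∣p∣≡1+t⇒p≡q∪⁅x⁆ (inside ∷ p) ∣p∣≡1+t =
  outside ∷ p , zero , (λ ()) , cong (inside ∷_) (sym (∪-identityʳ p)) , suc-injective ∣p∣≡1+t
∣p∣≡1+t⇒p≡q∪⁅x⁆ (outside ∷ p) ∣p∣≡1+t =
  let (q , x , x∉q , p≡q∪⁅x⁆ , ∣q∣≡t) = ∣p∣≡1+t⇒p≡q∪⁅x⁆ p ∣p∣≡1+t
  in outside ∷ q , suc x , (λ { (there x∈q) → x∉q x∈q }) , cong (outside ∷_) p≡q∪⁅x⁆ , ∣q∣≡t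

∣p∩q∣≡∣p∣⇒p∩q≡p : ∀ (p q : Subset n) → ∣ p ∣ ≡ ∣ p ∩ q ∣ → p ∩ q ≡ p
∣p∩q∣≡∣p∣⇒p∩q≡p [] [] _ = refl
∣p∩q∣≡∣p∣⇒p∩q≡p (inside ∷ p) (inside ∷ q) e = cong (inside ∷_) (∣p∩q∣≡∣p∣⇒p∩q≡p p q (suc-injective e))
∣p∩q∣≡∣p∣⇒p∩q≡p (inside ∷ p) (outside ∷ q) e = ⊥-elim (1+n≰n (≤-trans (≤-reflexive e) (∣p∩q∣≤∣p∣ p q)))
∣p∩q∣≡∣p∣⇒p∩q≡p (outside ∷ p) (_ ∷ q) e = cong (outside ∷_) (∣p∩q∣≡∣p∣⇒p∩q≡p p q e)

∣p∣≡1+∣p∩q∣⇒p≡p∩q∪⁅x⁆ : ∀ (p q : Subset n) → ∣ p ∣ ≡ suc ∣ p ∩ q ∣ →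
  ∃ λ x → x ∉ q × p ≡ (p ∩ q) ∪ ⁅ x ⁆
∣p∣≡1+∣p∩q∣⇒p≡p∩q∪⁅x⁆ (inside ∷ p) (inside ∷ q) e =
  let (x , x∉q , p≡) = ∣p∣≡1+∣p∩q∣⇒p≡p∩q∪⁅x⁆ p q (suc-injective e)
  in suc x , (λ { (there x∈q) → x∉q x∈q }) , cong (inside ∷_) p≡
∣p∣≡1+∣p∩q∣⇒p≡p∩q∪⁅x⁆ (inside ∷ p) (outside ∷ q) e =
  zero , (λ ()) ,
  cong (inside ∷_) (sym (trans (∪-identityʳ (p ∩ q)) (∣p∩q∣≡∣p∣⇒p∩q≡p p q (suc-injective e))))
∣p∣≡1+∣p∩q∣⇒p≡p∩q∪⁅x⁆ (outside ∷ p) (_ ∷ q) e =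
  let (x , x∉q , p≡) = ∣p∣≡1+∣p∩q∣⇒p≡p∩q∪⁅x⁆ p q e
  in suc x , (λ { (there x∈q) → x∉q x∈q }) , cong (outside ∷_) p≡

p∪⁅x⁆⊆q : ∀ {x} → p ⊆ q → x ∈ q → p ∪ ⁅ x ⁆ ⊆ q
p∪⁅x⁆⊆q {p = p} {q} {x} p⊆q x∈q y∈p∪⁅x⁆ =
  [ p⊆q , (λ y∈⁅x⁆ → subst (_∈ q) (sym (x∈⁅y⁆⇒x≡y x y∈⁅x⁆)) x∈q) ]′ (x∈p∪q⁻ p ⁅ x ⁆ y∈p∪⁅x⁆)

p⊆q∪⁅x⁆⇒∣p∣≡1+∣p∩q∣ : ∀ {x} → x ∈ p → x ∉ q → p ⊆ q ∪ ⁅ x ⁆ → ∣ p ∣ ≡ suc ∣ p ∩ q ∣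
p⊆q∪⁅x⁆⇒∣p∣≡1+∣p∩q∣ {p = p} {q} {x} x∈p x∉q p⊆q∪⁅x⁆ = begin
  ∣ p ∣                ≡⟨ cong ∣_∣ (⊆-antisym p⊆p∩q∪⁅x⁆ (p∪⁅x⁆⊆q (p∩q⊆p p q) x∈p)) ⟩
  ∣ (p ∩ q) ∪ ⁅ x ⁆ ∣  ≡⟨ ∣p∪⁅x⁆∣≡1+∣p∣ (p ∩ q) x (x∉q ∘ proj₂ ∘ x∈p∩q⁻ p q) ⟩
  suc ∣ p ∩ q ∣        ∎
  where
  open ≡-Reasoning
  p⊆p∩q∪⁅x⁆ : p ⊆ (p ∩ q) ∪ ⁅ x ⁆
  p⊆p∩q∪⁅x⁆ y∈p = [ (λ y∈q → x∈p∪q⁺ (inj₁ (x∈p∩q⁺ (y∈p , y∈q)))) , x∈p∪q⁺ ∘ inj₂ ]′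
                      (x∈p∪q⁻ q ⁅ x ⁆ (p⊆q∪⁅x⁆ y∈p))

∣[p∪⁅x⁆]∩q∣≡∣p∣ : ∀ {x} → p ⊆ q → x ∉ q → ∣ (p ∪ ⁅ x ⁆) ∩ q ∣ ≡ ∣ p ∣
∣[p∪⁅x⁆]∩q∣≡∣p∣ {p = p} {q} {x} p⊆q x∉q = suc-injective (begin
  suc ∣ (p ∪ ⁅ x ⁆) ∩ q ∣  ≡⟨ p⊆q∪⁅x⁆⇒∣p∣≡1+∣p∩q∣ (q⊆p∪q p ⁅ x ⁆ (x∈⁅x⁆ x)) x∉q p∪x⊆q∪x ⟨
  ∣ p ∪ ⁅ x ⁆ ∣            ≡⟨ ∣p∪⁅x⁆∣≡1+∣p∣ p x (x∉q ∘ p⊆q) ⟩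
  suc ∣ p ∣                ∎)
  where
  open ≡-Reasoning
  p∪x⊆q∪x : p ∪ ⁅ x ⁆ ⊆ q ∪ ⁅ x ⁆
  p∪x⊆q∪x = p∪⁅x⁆⊆q (λ y∈p → p⊆p∪q ⁅ x ⁆ (p⊆q y∈p)) (q⊆p∪q q ⁅ x ⁆ (x∈⁅x⁆ x))

p≢⊤⇒∃∉ : p ≢ ⊤ → ∃ λ x → x ∉ p
p≢⊤⇒∃∉ {p = p} p≢⊤ with any? (λ x → ¬? (x ∈? p))
... | yes x∉p = x∉p
... | no ∄x∉p =
  ⊥-elim (p≢⊤ (⊆-antisym ⊆⊤ (λ {x} _ → decidable-stable (x ∈? p) (λ x∉p → ∄x∉p (x , x∉p)))))

cons-injective : ∀ {A : Set} {a} {f : Fin k → A} →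
  Injective _≡_ _≡_ f → (∀ i → a ≢ f i) → Injective _≡_ _≡_ (a ∷ᶠ f)
cons-injective _ _ {zero} {zero} _ = refl
cons-injective _ a∉f {zero} {suc j} a≡fj = ⊥-elim (a∉f j a≡fj)
cons-injective _ a∉f {suc i} {zero} fi≡a = ⊥-elim (a∉f i (sym fi≡a))
cons-injective f-inj _ {suc i} {suc j} fi≡fj = cong suc (f-inj fi≡fj)

zeros : BoolMatrix m n → Fin m → Subset n
zeros M r = tabulate (not ∘ M r)

module _ (M : BoolMatrix m n) (r : Fin m) {x : Fin n} where

  ∈-zeros⁺ : M r x ≡ false → x ∈ zeros M r
  ∈-zeros⁺ Mrx≡0 = lookup⇒[]= x (zeros M r) (trans (lookup∘tabulate (not ∘ M r) x) (cong not Mrx≡0))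

  ∈-zeros⁻ : x ∈ zeros M r → M r x ≡ false
  ∈-zeros⁻ x∈zeros = not-injective (trans (sym (lookup∘tabulate (not ∘ M r) x)) ([]=⇒lookup x∈zeros))

  ∉-zeros⁻ : x ∉ zeros M r → M r x ≡ true
  ∉-zeros⁻ x∉zeros = ¬-not (x∉zeros ∘ ∈-zeros⁺)

unitriangular-⊥ : ∀ (M : BoolMatrix m n) → HasLowerUnitriangular M ⊥
unitriangular-⊥ M = 0 , (λ ()) , (λ ()) , (λ { {()} }) , (λ { {()} }) ,
  (λ _ → mk⇔ (⊥-elim ∘ ∉⊥) (λ { (() , _) })) , (λ ()) , (λ ())

unitriangular-∪⁅⁆ : ∀ (M : BoolMatrix m n) {r x} → M r x ≡ true → (∀ {y} → y ∈ p → M r y ≡ false) →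
  HasLowerUnitriangular M p → HasLowerUnitriangular M (p ∪ ⁅ x ⁆)
unitriangular-∪⁅⁆ {p = p} M {r} {x} Mrx≡1 Mr≡0
                  (k , rows , cols , rows-inj , cols-inj , enum , diag , upper) =
  suc k , r ∷ᶠ rows , x ∷ᶠ cols , cons-injective rows-inj r≢rows , cons-injective cols-inj x≢cols ,
  enum′ , (λ { zero → Mrx≡1 ; (suc i) → diag i }) , upper′
  where
  col∈p : ∀ i → cols i ∈ p
  col∈p i = from (enum (cols i)) (i , refl)
  r≢rows : ∀ i → r ≢ rows i
  r≢rows i r≡ri =
    contradiction (trans (sym (diag i)) (trans (cong (λ ρ → M ρ (cols i)) (sym r≡ri)) (Mr≡0 (col∈p i)))) λ ()
  x≢cols : ∀ i → x ≢ cols i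
  x≢cols i x≡ci = contradiction (trans (sym Mrx≡1) (trans (cong (M r) x≡ci) (Mr≡0 (col∈p i)))) λ ()
  enum′ : ∀ y → y ∈ p ∪ ⁅ x ⁆ ⇔ (∃ λ i → (x ∷ᶠ cols) i ≡ y)
  enum′ y = mk⇔
    (λ y∈ → [ (λ y∈p → let (i , ci≡y) = to (enum y) y∈p in suc i , ci≡y)
            , (λ y∈⁅x⁆ → zero , sym (x∈⁅y⁆⇒x≡y x y∈⁅x⁆)) ]′ (x∈p∪q⁻ p ⁅ x ⁆ y∈))
    (λ { (zero , refl) → x∈p∪q⁺ (inj₂ (x∈⁅x⁆ x))
       ; (suc i , ci≡y) → x∈p∪q⁺ (inj₁ (from (enum y) (i , ci≡y))) })
  upper′ : ∀ i j → i F.< j → M ((r ∷ᶠ rows) i) ((x ∷ᶠ cols) j) ≡ false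
  upper′ zero (suc j) _ = Mr≡0 (col∈p j)
  upper′ (suc i) (suc j) (s≤s i<j) = upper i j i<j

unitriangular-head : ∀ (M : BoolMatrix m n) → HasLowerUnitriangular M p → Nonempty p →
  ∃₂ λ r x → x ∈ p × M r x ≡ true × p ⊆ zeros M r ∪ ⁅ x ⁆
unitriangular-head M (zero , _ , _ , _ , _ , enum , _) (y , y∈p) with to (enum y) y∈p
... | () , _
unitriangular-head {p = p} M (suc k , rows , cols , _ , _ , enum , diag , upper) _ =
  rows zero , cols zero , from (enum (cols zero)) (zero , refl) , diag zero , covered
  where
  covered : p ⊆ zeros M (rows zero) ∪ ⁅ cols zero ⁆
  covered {y} y∈p with to (enum y) y∈p
  ... | zero , refl = x∈p∪q⁺ (inj₂ (x∈⁅x⁆ _))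
  ... | suc i , refl = x∈p∪q⁺ (inj₁ (∈-zeros⁺ M (rows zero) (upper zero (suc i) (s≤s z≤n))))

-- Rows of the flat matrix are indexed by an enumeration of all subsets.
subsetCount : ℕ → ℕ
subsetCount zero = 1
subsetCount (suc n) = subsetCount n + subsetCount n

decode : Fin (subsetCount n) → Subset n
decode {zero} _ = []
decode {suc n} i = [ (outside ∷_) ∘ decode , (inside ∷_) ∘ decode ]′ (splitAt (subsetCount n) i)

encode : Subset n → Fin (subsetCount n)
encode [] = zero
encode {suc n} (outside ∷ p) = encode p ↑ˡ subsetCount n
encode {suc n} (inside ∷ p) = subsetCount n ↑ʳ encode p

decode-encode : ∀ (p : Subset n) → decode (encode p) ≡ p
decode-encode [] = refl
decode-encode {suc n} (outside ∷ p)
  rewrite splitAt-↑ˡ (subsetCount n) (encode p) (subsetCount n) = cong (outside ∷_) (decode-encode p)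
decode-encode {suc n} (inside ∷ p)
  rewrite splitAt-↑ʳ (subsetCount n) (subsetCount n) (encode p) = cong (inside ∷_) (decode-encode p)

Represents : SimplicialComplex n → BoolMatrix m n → Set
Represents S M = ∀ X → Indep S X ⇔ HasLowerUnitriangular M X

module _ (S : SimplicialComplex n) where

  Indep-⊥ : Indep S ⊥
  Indep-⊥ = downClosed S ⁅ v ⁆ ⊥ ⊥⊆ (singletons S v)
    where v = F.fromℕ< (nonempty S)

  FlatViolation : Subset n → Subset n → Set
  FlatViolation Y I = Indep S I × I ⊆ Y × ∃ λ x → x ∉ Y × ¬ Indep S (I ∪ ⁅ x ⁆)

  flatViolation? : ∀ Y I → Dec (FlatViolation Y I)
  flatViolation? Y I =
    T? (ℋ S I) ×-dec I ⊆? Y ×-dec any? (λ x → ¬? (x ∈? Y) ×-dec ¬? (T? (ℋ S (I ∪ ⁅ x ⁆))))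

  isFlat? : ∀ Y → Dec (IsFlat S Y)
  isFlat? Y with anySubset? (flatViolation? Y)
  ... | yes (I , I∈ℋ , I⊆Y , x , x∉Y , I∪x∉ℋ) = no (λ Y-flat → I∪x∉ℋ (Y-flat I I∈ℋ I⊆Y x x∉Y))
  ... | no ∄violation = yes λ I I∈ℋ I⊆Y x x∉Y →
    decidable-stable (T? (ℋ S (I ∪ ⁅ x ⁆))) (λ I∪x∉ℋ → ∄violation (I , I∈ℋ , I⊆Y , x , x∉Y , I∪x∉ℋ))

  flatSeparated⇒Indep : ∀ k (Φ : Fin k → Subset n) (c : Fin k → Fin n) {X} →
    (∀ x → x ∈ X ⇔ (∃ λ i → c i ≡ x)) →
    (∀ i → IsFlat S (Φ i)) → (∀ i → c i ∉ Φ i) → (∀ i j → i F.< j → c j ∈ Φ i) →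
    Indep S X
  flatSeparated⇒Indep zero _ c {X} enum _ _ _ =
    downClosed S ⊥ X (λ {x} x∈X → case-fin0 (to (enum x) x∈X)) Indep-⊥
    where
    case-fin0 : ∀ {x} → (∃ λ (i : Fin 0) → c i ≡ x) → x ∈ ⊥
    case-fin0 (() , _)
  flatSeparated⇒Indep (suc k) Φ c {X} enum flat c∉Φ c∈Φ =
    downClosed S (X′ ∪ ⁅ c zero ⁆) X X⊆X′∪c₀
      (flat zero X′ X′∈ℋ (p∩q⊆q X (Φ zero)) (c zero) (c∉Φ zero))
    where
    X′ = X ∩ Φ zero
    enum′ : ∀ x → x ∈ X′ ⇔ (∃ λ i → c (suc i) ≡ x)
    enum′ x = mk⇔
      (λ x∈X′ → let (x∈X , x∈Φ₀) = x∈p∩q⁻ X (Φ zero) x∈X′ in case-suc (to (enum x) x∈X) x∈Φ₀)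
      (λ { (i , refl) → x∈p∩q⁺ (from (enum x) (suc i , refl) , c∈Φ zero (suc i) (s≤s z≤n)) })
      where
      case-suc : (∃ λ i → c i ≡ x) → x ∈ Φ zero → ∃ λ i → c (suc i) ≡ x
      case-suc (zero , refl) c₀∈Φ₀ = ⊥-elim (c∉Φ zero c₀∈Φ₀)
      case-suc (suc i , ci≡x) _ = i , ci≡x
    X′∈ℋ : Indep S X′
    X′∈ℋ = flatSeparated⇒Indep k (Φ ∘ suc) (c ∘ suc) enum′ (flat ∘ suc) (c∉Φ ∘ suc)
      (λ i j i<j → c∈Φ (suc i) (suc j) (s≤s i<j))
    X⊆X′∪c₀ : X ⊆ X′ ∪ ⁅ c zero ⁆
    X⊆X′∪c₀ {x} x∈X with to (enum x) x∈X
    ... | zero , refl = x∈p∪q⁺ (inj₂ (x∈⁅x⁆ _))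
    ... | suc i , refl = x∈p∪q⁺ (inj₁ (x∈p∩q⁺ (x∈X , c∈Φ zero (suc i) (s≤s z≤n))))

  zeros-isFlat : ∀ (M : BoolMatrix m n) → Represents S M → ∀ r → IsFlat S (zeros M r)
  zeros-isFlat M rep r I I∈ℋ I⊆zeros x x∉zeros = from (rep (I ∪ ⁅ x ⁆))
    (unitriangular-∪⁅⁆ M (∉-zeros⁻ M r x∉zeros) (∈-zeros⁻ M r ∘ I⊆zeros) (to (rep I) I∈ℋ))

  representable⇒flat-meeting : BooleanRepresentable S → ∀ {X} → Indep S X → ∣ X ∣ ≡ suc t →
    ∃ λ L → IsFlat S L × L ≢ ⊤ × ∣ X ∩ L ∣ ≡ t
  representable⇒flat-meeting (_ , M , rep) {X} X∈ℋ ∣X∣≡1+t =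
    let (r , x , x∈X , Mrx≡1 , X⊆) = unitriangular-head M (to (rep X) X∈ℋ) (∣p∣≡1+t⇒Nonempty X ∣X∣≡1+t)
        x∉zeros = λ x∈zeros → contradiction (trans (sym Mrx≡1) (∈-zeros⁻ M r x∈zeros)) λ ()
    in zeros M r , zeros-isFlat M rep r , (λ zeros≡⊤ → x∉zeros (subst (x ∈_) (sym zeros≡⊤) ∈⊤)) ,
       suc-injective (trans (sym (p⊆q∪⁅x⁆⇒∣p∣≡1+∣p∩q∣ x∈X x∉zeros X⊆)) ∣X∣≡1+t)

  flatRow : Subset n → Fin n → Bool
  flatRow Y x = ⌊ isFlat? Y ×-dec ¬? (x ∈? Y) ⌋

  flatMatrix : BoolMatrix (subsetCount n) n
  flatMatrix i = flatRow (decode i)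

  module _ {Y : Subset n} {x : Fin n} where

    flatRow-true⁻ : flatRow Y x ≡ true → IsFlat S Y × x ∉ Y
    flatRow-true⁻ e = toWitness (from T-≡ e)

    flatRow-false⁻ : IsFlat S Y → flatRow Y x ≡ false → x ∈ Y
    flatRow-false⁻ Y-flat e =
      decidable-stable (x ∈? Y) (λ x∉Y → toWitnessFalse (from T-not-≡ e) (Y-flat , x∉Y))

    flatRow-true⁺ : IsFlat S Y → x ∉ Y → flatRow Y x ≡ true
    flatRow-true⁺ Y-flat x∉Y = to T-≡ (fromWitness (Y-flat , x∉Y))

    flatRow-false⁺ : x ∈ Y → flatRow Y x ≡ false
    flatRow-false⁺ x∈Y = to T-not-≡ (fromWitnessFalse (λ (_ , x∉Y) → x∉Y x∈Y))

  flatMatrix-encode : ∀ Y → flatMatrix (encode Y) ≡ flatRow Y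
  flatMatrix-encode Y = cong flatRow (decode-encode Y)

  flatMatrix-sound : ∀ {X} → HasLowerUnitriangular flatMatrix X → Indep S X
  flatMatrix-sound (k , rows , cols , _ , _ , enum , diag , upper) =
    flatSeparated⇒Indep k (decode ∘ rows) cols enum (proj₁ ∘ row-true) (proj₂ ∘ row-true)
      (λ i j i<j → flatRow-false⁻ (proj₁ (row-true i)) (upper i j i<j))
    where
    row-true : ∀ i → IsFlat S (decode (rows i)) × cols i ∉ decode (rows i)
    row-true i = flatRow-true⁻ (diag i)

  flatMatrix-extend : ∀ {Y x} → IsFlat S Y → x ∉ Y → p ⊆ Y →
    HasLowerUnitriangular flatMatrix p → HasLowerUnitriangular flatMatrix (p ∪ ⁅ x ⁆)
  flatMatrix-extend {Y = Y} {x} Y-flat x∉Y p⊆Y = unitriangular-∪⁅⁆ flatMatrix {encode Y}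
    (trans (cong-app (flatMatrix-encode Y) x) (flatRow-true⁺ Y-flat x∉Y))
    (λ {y} y∈p → trans (cong-app (flatMatrix-encode Y) y) (flatRow-false⁺ (p⊆Y y∈p)))

module PavingComplex {n} (S : SimplicialComplex n) (d : ℕ) (1≤d : 1 ≤ d)
                     (dim : HasDim S d) (paving : Paving S d) where

  Indep⇒∣X∣≤1+d : ∀ {X} → Indep S X → ∣ X ∣ ≤ suc d
  Indep⇒∣X∣≤1+d = proj₂ dim _

  Indep⇒∣X∣≡1+d : ∀ {X} → Indep S X → ¬ ∣ X ∣ ≤ d → ∣ X ∣ ≡ suc d
  Indep⇒∣X∣≡1+d X∈ℋ ∣X∣≰d = ≤-antisym (Indep⇒∣X∣≤1+d X∈ℋ) (≰⇒> ∣X∣≰d)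

  ≥d⇒≰d∸1 : ∀ {a} → d ≤ a → ¬ a ≤ d ∸ 1
  ≥d⇒≰d∸1 d≤a a≤d∸1 = ≤⇒≯ d≤a (to (≤∸1⇔< 1≤d) a≤d∸1)

  ∣X∣≤d⇒Indep : ∀ X → ∣ X ∣ ≤ d → Indep S X
  ∣X∣≤d⇒Indep X ∣X∣≤d =
    let (I₀ , _ , ∣I₀∣≡1+d) = proj₁ dim
        (Y , X⊆Y , ∣Y∣≡d) = ∃-superset-of-size X d ∣X∣≤d (<⇒≤ (subst (_≤ n) ∣I₀∣≡1+d (∣p∣≤n I₀)))
    in downClosed S Y X X⊆Y (paving Y ∣Y∣≡d)

  ∣Y∣<d⇒IsFlat : ∀ Y → ∣ Y ∣ < d → IsFlat S Y
  ∣Y∣<d⇒IsFlat Y ∣Y∣<d I _ I⊆Y x x∉Y = ∣X∣≤d⇒Indep (I ∪ ⁅ x ⁆) (begin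
    ∣ I ∪ ⁅ x ⁆ ∣  ≡⟨ ∣p∪⁅x⁆∣≡1+∣p∣ I x (x∉Y ∘ I⊆Y) ⟩
    suc ∣ I ∣      ≤⟨ s≤s (p⊆q⇒∣p∣≤∣q∣ I⊆Y) ⟩
    suc ∣ Y ∣      ≤⟨ ∣Y∣<d ⟩
    d              ∎)
    where open ≤-Reasoning

  InB⇒Indep : ∀ {L X} → IsFlat S L → InB d L X → Indep S X
  InB⇒Indep {X = X} _ (inj₁ ∣X∣≤d) = ∣X∣≤d⇒Indep X ∣X∣≤d
  InB⇒Indep {L} {X} L-flat (inj₂ (∣X∣≡1+d , ∣X∩L∣≡d)) =
    let (x , x∉L , X≡) = ∣p∣≡1+∣p∩q∣⇒p≡p∩q∪⁅x⁆ X L (trans ∣X∣≡1+d (cong suc (sym ∣X∩L∣≡d)))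
    in subst (Indep S) (sym X≡)
         (L-flat (X ∩ L) (∣X∣≤d⇒Indep (X ∩ L) (≤-reflexive ∣X∩L∣≡d)) (p∩q⊆q X L) x x∉L)

  unitriangular-≤d : ∀ t X → ∣ X ∣ ≡ t → t ≤ d → HasLowerUnitriangular (flatMatrix S) X
  unitriangular-≤d zero X ∣X∣≡0 _ =
    subst (HasLowerUnitriangular (flatMatrix S)) (sym (∣p∣≡0⇒p≡⊥ X ∣X∣≡0))
      (unitriangular-⊥ (flatMatrix S))
  unitriangular-≤d (suc t) X ∣X∣≡1+t 1+t≤d =
    let (X′ , x , x∉X′ , X≡ , ∣X′∣≡t) = ∣p∣≡1+t⇒p≡q∪⁅x⁆ X ∣X∣≡1+t
        X′-flat = ∣Y∣<d⇒IsFlat X′ (subst (λ a → suc a ≤ d) (sym ∣X′∣≡t) 1+t≤d)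
    in subst (HasLowerUnitriangular (flatMatrix S)) (sym X≡)
         (flatMatrix-extend S X′-flat x∉X′ (λ y∈X′ → y∈X′) (unitriangular-≤d t X′ ∣X′∣≡t (<⇒≤ 1+t≤d)))

  FacetsMeetFlats : Set
  FacetsMeetFlats = ∀ X → Indep S X → ∣ X ∣ ≡ suc d → ∃ λ L → IsFlat S L × ∣ X ∩ L ∣ ≡ d

  facetsMeetFlats⇒representable : FacetsMeetFlats → BooleanRepresentable S
  facetsMeetFlats⇒representable meet =
    subsetCount n , flatMatrix S , λ X → mk⇔ (complete X) (flatMatrix-sound S)
    where
    complete : ∀ X → Indep S X → HasLowerUnitriangular (flatMatrix S) X
    complete X X∈ℋ with ∣ X ∣ ≤? d
    ... | yes ∣X∣≤d = unitriangular-≤d _ X refl ∣X∣≤d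
    ... | no ∣X∣≰d =
      let ∣X∣≡1+d = Indep⇒∣X∣≡1+d X∈ℋ ∣X∣≰d
          (L , L-flat , ∣X∩L∣≡d) = meet X X∈ℋ ∣X∣≡1+d
          (x , x∉L , X≡) = ∣p∣≡1+∣p∩q∣⇒p≡p∩q∪⁅x⁆ X L (trans ∣X∣≡1+d (cong suc (sym ∣X∩L∣≡d)))
      in subst (HasLowerUnitriangular (flatMatrix S)) (sym X≡)
           (flatMatrix-extend S L-flat x∉L (p∩q⊆q X L)
             (unitriangular-≤d _ (X ∩ L) refl (≤-reflexive ∣X∩L∣≡d)))

  -- Adding a point of B outside A, then a point outside B, to the d-set Z
  -- would give an independent (d+2)-set.
  proper-flat-through-d-set-⊆ : ∀ {A B Z} → IsFlat S A → IsFlat S B → B ≢ ⊤ →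
    ∣ Z ∣ ≡ d → Z ⊆ A → Z ⊆ B → B ⊆ A
  proper-flat-through-d-set-⊆ {A} {B} {Z} A-flat B-flat B≢⊤ ∣Z∣≡d Z⊆A Z⊆B {q} q∈B =
    decidable-stable (q ∈? A) λ q∉A →
      let (s , s∉B) = p≢⊤⇒∃∉ B≢⊤
          Z∪q⊆B = p∪⁅x⁆⊆q Z⊆B q∈B
          Z∪q∈ℋ = A-flat Z (paving Z ∣Z∣≡d) Z⊆A q q∉A
          Z∪q∪s∈ℋ = B-flat (Z ∪ ⁅ q ⁆) Z∪q∈ℋ Z∪q⊆B s s∉B
          ∣Z∪q∪s∣≡2+d = begin
            ∣ (Z ∪ ⁅ q ⁆) ∪ ⁅ s ⁆ ∣  ≡⟨ ∣p∪⁅x⁆∣≡1+∣p∣ (Z ∪ ⁅ q ⁆) s (s∉B ∘ Z∪q⊆B) ⟩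
            suc ∣ Z ∪ ⁅ q ⁆ ∣        ≡⟨ cong suc (∣p∪⁅x⁆∣≡1+∣p∣ Z q (q∉A ∘ Z⊆A)) ⟩
            suc (suc ∣ Z ∣)          ≡⟨ cong (λ a → suc (suc a)) ∣Z∣≡d ⟩
            suc (suc d)              ∎
      in 1+n≰n (subst (_≤ suc d) ∣Z∪q∪s∣≡2+d (Indep⇒∣X∣≤1+d Z∪q∪s∈ℋ))
    where open ≡-Reasoning

  distinct-proper-flats-∩<d : ∀ {A B} → IsFlat S A → IsFlat S B → A ≢ ⊤ → B ≢ ⊤ → A ≢ B →
    ∣ A ∩ B ∣ < d
  distinct-proper-flats-∩<d {A} {B} A-flat B-flat A≢⊤ B≢⊤ A≢B with ∣ A ∩ B ∣ <? d
  ... | yes ∣A∩B∣<d = ∣A∩B∣<d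
  ... | no ∣A∩B∣≮d =
    let (Z , Z⊆A∩B , ∣Z∣≡d) = ∃-subset-of-size (A ∩ B) d (≮⇒≥ ∣A∩B∣≮d)
        Z⊆A = ⊆-trans Z⊆A∩B (p∩q⊆p A B)
        Z⊆B = ⊆-trans Z⊆A∩B (p∩q⊆q A B)
    in ⊥-elim (A≢B (⊆-antisym (proper-flat-through-d-set-⊆ B-flat A-flat A≢⊤ ∣Z∣≡d Z⊆B Z⊆A)
                             (proper-flat-through-d-set-⊆ A-flat B-flat B≢⊤ ∣Z∣≡d Z⊆A Z⊆B)))

  Sparse : (Subset n → Bool) → Set
  Sparse 𝓛 = ∀ L L′ → T (𝓛 L) → T (𝓛 L′) → L ≢ L′ → ∣ L ∩ L′ ∣ ≤ d ∸ 1

  Generates : (Subset n → Bool) → Set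
  Generates 𝓛 = ∀ X → Indep S X ⇔ (∃ λ L → T (𝓛 L) × InB d L X)

  module _ {𝓛 : Subset n → Bool} (sparse : Sparse 𝓛) (generates : Generates 𝓛) where

    facet⊈member : ∀ {L I} → T (𝓛 L) → Indep S I → ∣ I ∣ ≡ suc d → ¬ I ⊆ L
    facet⊈member {L} {I} L∈𝓛 I∈ℋ ∣I∣≡1+d I⊆L with to (generates I) I∈ℋ
    ... | _ , _ , inj₁ ∣I∣≤d = 1+n≰n (subst (_≤ d) ∣I∣≡1+d ∣I∣≤d)
    ... | L′ , L′∈𝓛 , inj₂ (_ , ∣I∩L′∣≡d) with ≡-dec _≟ᴮ_ L L′
    ...   | yes refl = 1+n≰n (subst₂ _≤_ ∣I∣≡1+d ∣I∩L′∣≡d (p⊆q⇒∣p∣≤∣q∣ (λ i∈I → x∈p∩q⁺ (i∈I , I⊆L i∈I))))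
    ...   | no L≢L′ = ≤⇒≯ (subst (_≤ ∣ L ∩ L′ ∣) ∣I∩L′∣≡d (p⊆q⇒∣p∣≤∣q∣ I∩L′⊆L∩L′))
                          (to (≤∸1⇔< 1≤d) (sparse L L′ L∈𝓛 L′∈𝓛 L≢L′))
      where
      I∩L′⊆L∩L′ : I ∩ L′ ⊆ L ∩ L′
      I∩L′⊆L∩L′ i∈ = let (i∈I , i∈L′) = x∈p∩q⁻ I L′ i∈ in x∈p∩q⁺ (I⊆L i∈I , i∈L′)

    member-isFlat : ∀ {L} → T (𝓛 L) → IsFlat S L
    member-isFlat {L} L∈𝓛 I I∈ℋ I⊆L x x∉L with <-cmp ∣ I ∣ d
    ... | tri< ∣I∣<d _ _ =
      ∣X∣≤d⇒Indep (I ∪ ⁅ x ⁆) (subst (_≤ d) (sym (∣p∪⁅x⁆∣≡1+∣p∣ I x (x∉L ∘ I⊆L))) ∣I∣<d)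
    ... | tri≈ _ ∣I∣≡d _ = from (generates (I ∪ ⁅ x ⁆)) (L , L∈𝓛 , inj₂
      (trans (∣p∪⁅x⁆∣≡1+∣p∣ I x (x∉L ∘ I⊆L)) (cong suc ∣I∣≡d) , trans (∣[p∪⁅x⁆]∩q∣≡∣p∣ I⊆L x∉L) ∣I∣≡d))
    ... | tri> _ _ ∣I∣>d =
      ⊥-elim (facet⊈member L∈𝓛 I∈ℋ (≤-antisym (Indep⇒∣X∣≤1+d I∈ℋ) ∣I∣>d) I⊆L)

  GeneratedByFlats : Set
  GeneratedByFlats = ∀ X → Indep S X ⇔ (∃ λ L → IsFlat S L × ¬ (∣ L ∣ ≤ d ∸ 1) × L ≢ ⊤ × InB d L X)

  GeneratedBySparseFamily : Set
  GeneratedBySparseFamily = ∃ λ (𝓛 : Subset n → Bool) →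
    (∃ λ L → T (𝓛 L)) × (∀ L → T (𝓛 L) → d ≤ ∣ L ∣ × L ≢ ⊤) × Sparse 𝓛 × Generates 𝓛

  representable⇒generatedByFlats : BooleanRepresentable S → GeneratedByFlats
  representable⇒generatedByFlats rep X = mk⇔ cover (λ (_ , L-flat , _ , _ , X∈B) → InB⇒Indep L-flat X∈B)
    where
    bigProperFlat : ∀ {Y} → Indep S Y → ∣ Y ∣ ≡ suc d →
      ∃ λ L → IsFlat S L × ¬ (∣ L ∣ ≤ d ∸ 1) × L ≢ ⊤ × ∣ Y ∩ L ∣ ≡ d
    bigProperFlat {Y} Y∈ℋ ∣Y∣≡1+d =
      let (L , L-flat , L≢⊤ , ∣Y∩L∣≡d) = representable⇒flat-meeting S rep Y∈ℋ ∣Y∣≡1+d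
      in L , L-flat , ≥d⇒≰d∸1 (subst (_≤ ∣ L ∣) ∣Y∩L∣≡d (∣p∩q∣≤∣q∣ Y L)) , L≢⊤ , ∣Y∩L∣≡d
    cover : Indep S X → ∃ λ L → IsFlat S L × ¬ (∣ L ∣ ≤ d ∸ 1) × L ≢ ⊤ × InB d L X
    cover X∈ℋ with ∣ X ∣ ≤? d
    ... | yes ∣X∣≤d =
      let (_ , I₀∈ℋ , ∣I₀∣≡1+d) = proj₁ dim
          (L , L-flat , L-big , L≢⊤ , _) = bigProperFlat I₀∈ℋ ∣I₀∣≡1+d
      in L , L-flat , L-big , L≢⊤ , inj₁ ∣X∣≤d
    ... | no ∣X∣≰d =
      let ∣X∣≡1+d = Indep⇒∣X∣≡1+d X∈ℋ ∣X∣≰d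
          (L , L-flat , L-big , L≢⊤ , ∣X∩L∣≡d) = bigProperFlat X∈ℋ ∣X∣≡1+d
      in L , L-flat , L-big , L≢⊤ , inj₂ (∣X∣≡1+d , ∣X∩L∣≡d)

  generatedByFlats⇒representable : GeneratedByFlats → BooleanRepresentable S
  generatedByFlats⇒representable generated = facetsMeetFlats⇒representable meet
    where
    meet : FacetsMeetFlats
    meet X X∈ℋ ∣X∣≡1+d with to (generated X) X∈ℋ
    ... | _ , _ , _ , _ , inj₁ ∣X∣≤d = ⊥-elim (1+n≰n (subst (_≤ d) ∣X∣≡1+d ∣X∣≤d))
    ... | L , L-flat , _ , _ , inj₂ (_ , ∣X∩L∣≡d) = L , L-flat , ∣X∩L∣≡d

  generatedByFlats⇒generatedBySparseFamily : GeneratedByFlats → GeneratedBySparseFamily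
  generatedByFlats⇒generatedBySparseFamily generated =
    𝓛 , nonempty-𝓛 , (λ L L∈𝓛 → big (proj₁ (proj₂ (∈𝓛⁻ L∈𝓛))) , proj₂ (proj₂ (∈𝓛⁻ L∈𝓛))) ,
    sparse , generates
    where
    BigProperFlat : Subset n → Set
    BigProperFlat L = IsFlat S L × ¬ (∣ L ∣ ≤ d ∸ 1) × L ≢ ⊤
    bigProperFlat? : ∀ L → Dec (BigProperFlat L)
    bigProperFlat? L = isFlat? S L ×-dec ¬? (∣ L ∣ ≤? d ∸ 1) ×-dec ¬? (≡-dec _≟ᴮ_ L ⊤)
    𝓛 : Subset n → Bool
    𝓛 L = ⌊ bigProperFlat? L ⌋
    ∈𝓛⁻ : ∀ {L} → T (𝓛 L) → BigProperFlat L
    ∈𝓛⁻ {L} = toWitness {a? = bigProperFlat? L}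
    ∈𝓛⁺ : ∀ {L} → BigProperFlat L → T (𝓛 L)
    ∈𝓛⁺ {L} = fromWitness {a? = bigProperFlat? L}
    big : ∀ {a} → ¬ (a ≤ d ∸ 1) → d ≤ a
    big a≰d∸1 = ≮⇒≥ (a≰d∸1 ∘ from (≤∸1⇔< 1≤d))
    nonempty-𝓛 : ∃ λ L → T (𝓛 L)
    nonempty-𝓛 =
      let (I₀ , I₀∈ℋ , _) = proj₁ dim
          (L , L-flat , L-big , L≢⊤ , _) = to (generated I₀) I₀∈ℋ
      in L , ∈𝓛⁺ (L-flat , L-big , L≢⊤)
    sparse : Sparse 𝓛
    sparse L L′ L∈𝓛 L′∈𝓛 L≢L′ =
      let (L-flat , _ , L≢⊤) = ∈𝓛⁻ L∈𝓛
          (L′-flat , _ , L′≢⊤) = ∈𝓛⁻ L′∈𝓛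
      in from (≤∸1⇔< 1≤d) (distinct-proper-flats-∩<d L-flat L′-flat L≢⊤ L′≢⊤ L≢L′)
    generates : Generates 𝓛
    generates X = mk⇔
      (λ X∈ℋ → let (L , L-flat , L-big , L≢⊤ , X∈B) = to (generated X) X∈ℋ
               in L , ∈𝓛⁺ (L-flat , L-big , L≢⊤) , X∈B)
      (λ (L , L∈𝓛 , X∈B) → InB⇒Indep (proj₁ (∈𝓛⁻ L∈𝓛)) X∈B)

  generatedBySparseFamily⇒generatedByFlats : GeneratedBySparseFamily → GeneratedByFlats
  generatedBySparseFamily⇒generatedByFlats (𝓛 , _ , members , sparse , generates) X = mk⇔
    (λ X∈ℋ → let (L , L∈𝓛 , X∈B) = to (generates X) X∈ℋ
                 (d≤∣L∣ , L≢⊤) = members L L∈𝓛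
             in L , member-isFlat sparse generates L∈𝓛 , ≥d⇒≰d∸1 d≤∣L∣ , L≢⊤ , X∈B)
    (λ (_ , L-flat , _ , _ , X∈B) → InB⇒Indep L-flat X∈B)

theorem5p8 : ∀ {n} (d : ℕ) → 2 ≤ d → (S : SimplicialComplex n) → HasDim S d → Paving S d →
    (BooleanRepresentable S
      ⇔ (∀ X → Indep S X ⇔ (∃ λ L → IsFlat S L × ¬ (∣ L ∣ ≤ d ∸ 1) × L ≢ ⊤ × InB d L X)))
    × (BooleanRepresentable S
      ⇔ (∃ λ (𝓛 : Subset n → Bool) →
            (∃ λ L → T (𝓛 L))
          × (∀ L → T (𝓛 L) → d ≤ ∣ L ∣ × L ≢ ⊤)
          × (∀ L L′ → T (𝓛 L) → T (𝓛 L′) → L ≢ L′ → ∣ L ∩ L′ ∣ ≤ d ∸ 1)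
          × (∀ X → Indep S X ⇔ (∃ λ L → T (𝓛 L) × InB d L X))))
theorem5p8 d 2≤d S dim paving =
  mk⇔ representable⇒generatedByFlats generatedByFlats⇒representable ,
  mk⇔ (generatedByFlats⇒generatedBySparseFamily ∘ representable⇒generatedByFlats)
      (generatedByFlats⇒representable ∘ generatedBySparseFamily⇒generatedByFlats)
  where open PavingComplex S d (≤-trans (s≤s z≤n) 2≤d) dim paving
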